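{- Let $d,n,m,s$ be positive integers satisfying $F_n^s+F_{n+d}^s=F_m$. Then \[s(n+d-2)+1<m\le s(n+d-1)+2.\]
   Context: The Fibonacci sequence is defined by $F_0=0$, $F_1=1$ and $F_{n+2}=F_{n+1}+F_n$ for $n\ge 0$. -}

module Defs where

open import Data.Nat using (ℕ; zero; suc; _+_)

F : ℕ → ℕ
F zero = 0
F (suc zero) = 1
F (suc (suc n)) = F (suc n) + F n

-- With N = n + d ≥ 2 and 1 ≤ F n ≤ F N, the equation squeezes F m strictly between F N ^ s
-- and 2 · F N ^ s. The addition formula F (1 + a + b) = F (a + 1) F (b + 1) + F a F b makes F
-- roughly multiplicative: F (1 + s (N - 2)) ≤ F N ^ s, while 2 · F N ^ s < F (3 + s (N - 1)).
-- Since F is monotone, these bounds on F m translate into bounds on m.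
module Submission where

open import Defs
open import Data.Nat using (ℕ; _+_; _*_; _∸_; _^_; _≤_; _<_; _≤′_; ≤′-refl; ≤′-step; zero; suc; z≤n; s≤s; s≤s⁻¹; _<?_)
open import Data.Nat.Properties
open import Data.Nat.Solver using (module +-*-Solver)
open import Data.Product using (_×_; _,_)
open import Relation.Binary.PropositionalEquality
open import Relation.Nullary using (yes; no; contradiction)
open import Function using (_∘_)

open import Algebra.Properties.CommutativeSemigroup *-commutativeSemigroup using (x∙yz≈y∙xz)

open +-*-Solver

+-suc-suc : ∀ p r → p + suc (suc r) ≡ suc (suc (p + r))
+-suc-suc p r = trans (+-suc p (suc r)) (cong suc (+-suc p r))

F-suc-+ : ∀ a b → F (suc (a + b)) ≡ F (suc a) * F (suc b) + F a * F b
F-suc-+ zero b = sym (trans (+-identityʳ _) (+-identityʳ _))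
F-suc-+ (suc a) b = begin
    F (suc (suc a + b))
  ≡⟨ cong (λ x → F (suc x)) (sym (+-suc a b)) ⟩
    F (suc (a + suc b))
  ≡⟨ F-suc-+ a (suc b) ⟩
    F (suc a) * (F (suc b) + F b) + F a * F (suc b)
  ≡⟨ solve 4 (λ x y u v → x :* (u :+ v) :+ y :* u := (x :+ y) :* u :+ x :* v) refl
       (F (suc a)) (F a) (F (suc b)) (F b) ⟩
    (F (suc a) + F a) * F (suc b) + F (suc a) * F b
  ∎
  where open ≡-Reasoning

F-pos : ∀ n → 1 ≤ F (suc n)
F-pos zero = ≤-refl
F-pos (suc n) = ≤-trans (F-pos n) (m≤m+n _ _)

F-≤-suc : ∀ n → F n ≤ F (suc n)
F-≤-suc zero = z≤n
F-≤-suc (suc n) = m≤m+n _ _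

F-mono-≤′ : ∀ {m n} → m ≤′ n → F m ≤ F n
F-mono-≤′ ≤′-refl = ≤-refl
F-mono-≤′ (≤′-step {n} m≤′n) = ≤-trans (F-mono-≤′ m≤′n) (F-≤-suc n)

F-mono-≤ : ∀ {m n} → m ≤ n → F m ≤ F n
F-mono-≤ m≤n = F-mono-≤′ (≤⇒≤′ m≤n)

F-cancel-< : ∀ {m n} → F m < F n → m < n
F-cancel-< {m} {n} Fm<Fn with m <? n
... | yes m<n = m<n
... | no m≮n = contradiction Fm<Fn (≤⇒≯ (F-mono-≤ (≮⇒≥ m≮n)))

F-*-≤ : ∀ a b → F (suc a) * F (suc b) ≤ F (suc (a + b))
F-*-≤ a b = ≤-trans (m≤m+n _ _) (≤-reflexive (sym (F-suc-+ a b)))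

F-*-< : ∀ a b → F (2 + a) * F (2 + b) < F (2 + (a + suc b))
F-*-< a b =
  ≤-trans (m<m+n _ (*-mono-≤ (F-pos a) (F-pos b))) (≤-reflexive (sym (F-suc-+ (suc a) (suc b))))

F-suc-≤-* : ∀ a b → F (suc (a + b)) ≤ F (2 + a) * F (suc b)
F-suc-≤-* a b = begin
    F (suc (a + b))
  ≡⟨ F-suc-+ a b ⟩
    F (suc a) * F (suc b) + F a * F b
  ≤⟨ +-monoʳ-≤ (F (suc a) * F (suc b)) (*-monoʳ-≤ (F a) (F-≤-suc b)) ⟩
    F (suc a) * F (suc b) + F a * F (suc b)
  ≡⟨ sym (*-distribʳ-+ (F (suc b)) (F (suc a)) (F a)) ⟩
    F (2 + a) * F (suc b)
  ∎
  where open ≤-Reasoning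

F-suc-*-≤-^ : ∀ p k → F (suc (k * p)) ≤ F (2 + p) ^ k
F-suc-*-≤-^ p zero = ≤-refl
F-suc-*-≤-^ p (suc k) =
  ≤-trans (F-suc-≤-* p (k * p)) (*-monoʳ-≤ (F (2 + p)) (F-suc-*-≤-^ p k))

double-F-^-≤ : ∀ q k → 2 * F (suc q) ^ k ≤ F (3 + k * q)
double-F-^-≤ q zero = ≤-refl
double-F-^-≤ q (suc k) = begin
    2 * (F (suc q) * F (suc q) ^ k)
  ≡⟨ x∙yz≈y∙xz 2 (F (suc q)) (F (suc q) ^ k) ⟩
    F (suc q) * (2 * F (suc q) ^ k)
  ≤⟨ *-monoʳ-≤ (F (suc q)) (double-F-^-≤ q k) ⟩
    F (suc q) * F (3 + k * q)
  ≤⟨ F-*-≤ q (2 + k * q) ⟩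
    F (suc (q + suc (suc (k * q))))
  ≡⟨ cong (F ∘ suc) (+-suc-suc q (k * q)) ⟩
    F (3 + suc k * q)
  ∎
  where open ≤-Reasoning

double-F-^-< : ∀ p k → 2 * F (2 + p) ^ suc k < F (3 + suc k * suc p)
double-F-^-< p k = begin-strict
    2 * (F (2 + p) * F (2 + p) ^ k)
  ≡⟨ x∙yz≈y∙xz 2 (F (2 + p)) (F (2 + p) ^ k) ⟩
    F (2 + p) * (2 * F (2 + p) ^ k)
  ≤⟨ *-monoʳ-≤ (F (2 + p)) (double-F-^-≤ (suc p) k) ⟩
    F (2 + p) * F (2 + suc (k * suc p))
  <⟨ F-*-< p (suc (k * suc p)) ⟩
    F (2 + (p + suc (suc (k * suc p))))
  ≡⟨ cong (F ∘ suc ∘ suc) (+-suc-suc p (k * suc p)) ⟩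
    F (3 + suc k * suc p)
  ∎
  where open ≤-Reasoning

F-index-lower : ∀ p k m → F (2 + p) ^ k < F m → k * p + 1 < m
F-index-lower p k m N^k<Fm =
  subst (_< m) (+-comm 1 (k * p)) (F-cancel-< (≤-<-trans (F-suc-*-≤-^ p k) N^k<Fm))

F-index-upper : ∀ p k m → 1 ≤ k → F m ≤ 2 * F (2 + p) ^ k → m ≤ k * suc p + 2
F-index-upper p (suc j) m _ Fm≤2N^k =
  subst (m ≤_) (+-comm 2 (suc j * suc p)) (s≤s⁻¹ (F-cancel-< (≤-<-trans Fm≤2N^k (double-F-^-< p j))))

lemma4p5 : (d n m s : ℕ) → 1 ≤ d → 1 ≤ n → 1 ≤ m → 1 ≤ s →
    F n ^ s + F (n + d) ^ s ≡ F m →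
    (s * (n + d ∸ 2) + 1 < m) × (m ≤ s * (n + d ∸ 1) + 2)
-- Rewriting n + d to 2 + p makes the truncated subtractions in the statement compute.
lemma4p5 (suc d) (suc n) m s _ _ _ 1≤s eq rewrite +-suc n d =
  F-index-lower p s m N^s<Fm , F-index-upper p s m 1≤s Fm≤2N^s
  where
  p = n + d
  N^s<Fm : F (2 + p) ^ s < F m
  N^s<Fm = ≤-trans (+-monoˡ-≤ (F (2 + p) ^ s) 1≤Fn^s) (≤-reflexive eq)
    where
    1≤Fn^s : 1 ≤ F (suc n) ^ s
    1≤Fn^s = subst (_≤ F (suc n) ^ s) (^-zeroˡ s) (^-monoˡ-≤ s (F-pos n))
  Fm≤2N^s : F m ≤ 2 * F (2 + p) ^ s
  Fm≤2N^s = begin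
      F m
    ≡⟨ sym eq ⟩
      F (suc n) ^ s + F (2 + p) ^ s
    ≤⟨ +-monoˡ-≤ (F (2 + p) ^ s) (^-monoˡ-≤ s (F-mono-≤ (m≤n⇒m≤1+n (s≤s (m≤m+n n d))))) ⟩
      F (2 + p) ^ s + F (2 + p) ^ s
    ≡⟨ cong (F (2 + p) ^ s +_) (sym (+-identityʳ _)) ⟩
      2 * F (2 + p) ^ s
    ∎
    where open ≤-Reasoning
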